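{- Let $P_1,P_2,P_3$ be the three paths of a cross-theta in an oriented hypergraph, with common end-points a vertex $v$ and an edge $e$, and for $1\le i<j\le 3$ let $C_{ij}$ be the circle formed by $P_i\cup P_j$. Then an odd number of the circles $C_{12},C_{13},C_{23}$ are negative.
   Context: An oriented hypergraph has vertices $V$, edges $E$, incidences $(v,e,k)$ ($1\le k\le\iota(v,e)$ for an incidence function $\iota:V\times E\to\mathbb Z_{\ge0}$), and an orientation $\sigma$ assigning $\pm1$ to each incidence. A path is a sequence $a_0,i_1,a_1,\dots,i_m,a_m$ alternating vertices and edges with $i_j$ an incidence containing $a_{j-1},a_j$ and nothing repeated. A circle of length $k$ is a closed such sequence $a_0,i_1,\dots,i_{2k},a_{2k}$ ($k$ vertices, $k$ edges, $2k$ incidences, nothing repeated except $a_0=a_{2k}$) with sign $(-1)^k\prod_{h=1}^{2k}\sigma(i_h)$; it is negative if this sign is $-1$. A cross-theta is a set of three pairwise internally disjoint paths (sharing only their end-points) with the same two end-points, one a vertex and the other an edge; the union of any two of its paths is a circle. -}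

module Defs where

open import Data.Nat using (ℕ; zero; suc; _+_; ⌊_/2⌋)
open import Data.Fin using (Fin)
open import Data.Empty using (⊥)
open import Data.Sign using (Sign) renaming (_*_ to _*ₛ_)
open import Data.Product using (Σ; Σ-syntax; _×_; _,_; proj₁; proj₂)
open import Data.Sum using (_⊎_; inj₁; inj₂)
open import Data.List using (List; []; _∷_; length; foldr)
open import Data.List.Membership.Propositional using (_∈_)
open import Data.List.Relation.Unary.Unique.Propositional using (Unique)
open import Relation.Binary.PropositionalEquality using (_≡_)

-- An oriented hypergraph: vertices V, edges E, incidence function ι,
-- incidences (v , e , k) with k ∈ Fin (ι v e) (standing for 1 ≤ k ≤ ι(v,e)),
-- and an orientation σ assigning a sign to every incidence.
record OrientedHypergraph : Set₁ where
  field
    V : Set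
    E : Set
    ι : V → E → ℕ
    σ : (Σ[ v ∈ V ] Σ[ e ∈ E ] Fin (ι v e)) → Sign

module _ (H : OrientedHypergraph) where
  open OrientedHypergraph H

  Incidence : Set
  Incidence = Σ[ v ∈ V ] Σ[ e ∈ E ] Fin (ι v e)

  incVertex : Incidence → V
  incVertex i = proj₁ i

  incEdge : Incidence → E
  incEdge i = proj₁ (proj₂ i)

  Elem : Set
  Elem = V ⊎ E

  -- incidence i contains a and b, going from a to b (one is the vertex of i,
  -- the other the edge of i; this forces alternation of vertices and edges)
  Connects : Incidence → Elem → Elem → Set
  Connects i a b =
    (a ≡ inj₁ (incVertex i) × b ≡ inj₂ (incEdge i))
    ⊎ (a ≡ inj₂ (incEdge i) × b ≡ inj₁ (incVertex i))

  data Walk : Elem → Elem → Set where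
    []  : ∀ {x} → Walk x x
    step : ∀ {x y z} (i : Incidence) → Connects i x y → Walk y z → Walk x z

  elems : ∀ {x y} → Walk x y → List Elem
  elems {x} [] = x ∷ []
  elems {x} (step i c w) = x ∷ elems w

  incs : ∀ {x y} → Walk x y → List Incidence
  incs [] = []
  incs (step i c w) = i ∷ incs w

  IsPath : ∀ {x y} → Walk x y → Set
  IsPath w = Unique (elems w) × Unique (incs w)

  _++ʷ_ : ∀ {x y z} → Walk x y → Walk y z → Walk x z
  [] ++ʷ w' = w'
  step i c w ++ʷ w' = step i c (w ++ʷ w')

  flipConnects : ∀ {i a b} → Connects i a b → Connects i b a
  flipConnects (inj₁ (p , q)) = inj₂ (q , p)
  flipConnects (inj₂ (p , q)) = inj₁ (q , p)

  reverseʷ : ∀ {x y} → Walk x y → Walk y x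
  reverseʷ [] = []
  reverseʷ {x} (step {y = y} i c w) = reverseʷ w ++ʷ step {y = x} i (flipConnects {i} {x} {y} c) []

  signPow : ℕ → Sign
  signPow zero = Sign.+
  signPow (suc n) = Sign.- *ₛ signPow n

  circleSign : ∀ {x} → Walk x x → Sign
  circleSign w =
    signPow ⌊ length (incs w) /2⌋ *ₛ foldr (λ i s → σ i *ₛ s) Sign.+ (incs w)

  IsNegative : ∀ {x} → Walk x x → Set
  IsNegative w = circleSign w ≡ Sign.-

  InternallyDisjoint : ∀ {v e} → Walk (inj₁ v) (inj₂ e) → Walk (inj₁ v) (inj₂ e) → Set
  InternallyDisjoint {v} {e} P Q =
    (∀ a → a ∈ elems P → a ∈ elems Q → (a ≡ inj₁ v) ⊎ (a ≡ inj₂ e))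
    × (∀ i → i ∈ incs P → i ∈ incs Q → ⊥)

  IsCrossTheta : ∀ {v e} → (P₁ P₂ P₃ : Walk (inj₁ v) (inj₂ e)) → Set
  IsCrossTheta P₁ P₂ P₃ =
    IsPath P₁ × IsPath P₂ × IsPath P₃
    × InternallyDisjoint P₁ P₂ × InternallyDisjoint P₁ P₃ × InternallyDisjoint P₂ P₃

  circleOf : ∀ {v e} → Walk (inj₁ v) (inj₂ e) → Walk (inj₁ v) (inj₂ e) → Walk (inj₁ v) (inj₁ v)
  circleOf P Q = P ++ʷ reverseʷ Q

  negCount : Sign → ℕ
  negCount Sign.- = 1
  negCount Sign.+ = 0

-- A path from the vertex v to the edge e alternates vertices and edges, so it has
-- odd length 2k + 1; call (-1)^k ∏ σ its sign. The circle P ∪ Q then has 2(kP + kQ + 1)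
-- incidences, so its sign is -(sign P)(sign Q). The product of the three circle signs
-- is -(sign P₁ sign P₂ sign P₃)² = -1, hence an odd number of them is negative.
module Submission where

open import Defs
open import Data.Nat using (ℕ; zero; suc; _+_; _%_; ⌊_/2⌋)
open import Data.Nat.Properties using (+-suc; n≡⌊n+n/2⌋)
open import Data.Nat.Tactic.RingSolver using (solve-∀)
open import Data.Sign using (Sign) renaming (_*_ to _*ₛ_)
open import Data.Sign.Properties using (*-assoc; *-comm; *-identityˡ; *-identityʳ; *-commutativeSemigroup)
open import Algebra.Properties.CommutativeSemigroup *-commutativeSemigroup using (interchange)
open import Data.Product using (Σ-syntax; _,_; proj₁; proj₂)
open import Data.Sum using (inj₁; inj₂)
open import Data.List using (List; []; _∷_; _++_; [_]; length; foldr; reverse)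
open import Data.List.Properties using (length-++; length-reverse; unfold-reverse)
open import Relation.Binary.PropositionalEquality using (_≡_; refl; sym; trans; cong; cong₂; module ≡-Reasoning)
open ≡-Reasoning

signPow-+ : ∀ H m n → signPow H m *ₛ signPow H n ≡ signPow H (m + n)
signPow-+ H zero n = *-identityˡ (signPow H n)
signPow-+ H (suc m) n = trans (*-assoc Sign.- (signPow H m) (signPow H n)) (cong (Sign.- *ₛ_) (signPow-+ H m n))

⌊odd+odd/2⌋ : ∀ a b → ⌊ suc (a + a) + suc (b + b) /2⌋ ≡ suc (a + b)
⌊odd+odd/2⌋ a b = begin
  ⌊ suc (a + a) + suc (b + b) /2⌋     ≡⟨ cong ⌊_/2⌋ (regroup a b) ⟩
  ⌊ suc (a + b) + suc (a + b) /2⌋     ≡⟨ sym (n≡⌊n+n/2⌋ (suc (a + b))) ⟩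
  suc (a + b)                         ∎
  where
  regroup : ∀ a b → suc (a + a) + suc (b + b) ≡ suc (a + b) + suc (a + b)
  regroup = solve-∀

negCount-pairwise-odd : ∀ H a b c →
  (negCount H (Sign.- *ₛ (a *ₛ b)) + negCount H (Sign.- *ₛ (a *ₛ c)) + negCount H (Sign.- *ₛ (b *ₛ c))) % 2 ≡ 1
negCount-pairwise-odd _ Sign.- Sign.- Sign.- = refl
negCount-pairwise-odd _ Sign.- Sign.- Sign.+ = refl
negCount-pairwise-odd _ Sign.- Sign.+ Sign.- = refl
negCount-pairwise-odd _ Sign.- Sign.+ Sign.+ = refl
negCount-pairwise-odd _ Sign.+ Sign.- Sign.- = refl
negCount-pairwise-odd _ Sign.+ Sign.- Sign.+ = refl
negCount-pairwise-odd _ Sign.+ Sign.+ Sign.- = refl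
negCount-pairwise-odd _ Sign.+ Sign.+ Sign.+ = refl

module _ {H : OrientedHypergraph} where
  open OrientedHypergraph H

  σ-product : List (Incidence H) → Sign
  σ-product = foldr (λ i s → σ i *ₛ s) Sign.+

  σ-product-++ : ∀ is js → σ-product (is ++ js) ≡ σ-product is *ₛ σ-product js
  σ-product-++ [] js = sym (*-identityˡ (σ-product js))
  σ-product-++ (i ∷ is) js =
    trans (cong (σ i *ₛ_) (σ-product-++ is js)) (sym (*-assoc (σ i) (σ-product is) (σ-product js)))

  σ-product-reverse : ∀ is → σ-product (reverse is) ≡ σ-product is
  σ-product-reverse [] = refl
  σ-product-reverse (i ∷ is) = begin
    σ-product (reverse (i ∷ is))              ≡⟨ cong σ-product (unfold-reverse i is) ⟩
    σ-product (reverse is ++ [ i ])           ≡⟨ σ-product-++ (reverse is) [ i ] ⟩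
    σ-product (reverse is) *ₛ (σ i *ₛ Sign.+) ≡⟨ cong₂ _*ₛ_ (σ-product-reverse is) (*-identityʳ (σ i)) ⟩
    σ-product is *ₛ σ i                       ≡⟨ *-comm (σ-product is) (σ i) ⟩
    σ-product (i ∷ is)                        ∎

  incs-++ʷ : ∀ {x y z} (w : Walk H x y) (w′ : Walk H y z) → incs H (_++ʷ_ H w w′) ≡ incs H w ++ incs H w′
  incs-++ʷ [] w′ = refl
  incs-++ʷ (step i c w) w′ = cong (i ∷_) (incs-++ʷ w w′)

  incs-reverseʷ : ∀ {x y} (w : Walk H x y) → incs H (reverseʷ H w) ≡ reverse (incs H w)
  incs-reverseʷ [] = refl
  incs-reverseʷ {x} (step {y = y} i c w) = begin
    incs H (reverseʷ H (step i c w))  ≡⟨ incs-++ʷ (reverseʷ H w) (step i (flipConnects H {i} {x} {y} c) []) ⟩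
    incs H (reverseʷ H w) ++ [ i ]    ≡⟨ cong (_++ [ i ]) (incs-reverseʷ w) ⟩
    reverse (incs H w) ++ [ i ]       ≡⟨ sym (unfold-reverse i (incs H w)) ⟩
    reverse (i ∷ incs H w)            ∎

  mutual
    vertex-edge-walk-odd : ∀ {v e} (w : Walk H (inj₁ v) (inj₂ e)) → Σ[ k ∈ ℕ ] length (incs H w) ≡ suc (k + k)
    vertex-edge-walk-odd (step i (inj₁ (refl , refl)) w) with edge-edge-walk-even w
    ... | k , len≡ = k , cong suc len≡
    vertex-edge-walk-odd (step i (inj₂ (() , _)) w)

    edge-edge-walk-even : ∀ {e e′} (w : Walk H (inj₂ e) (inj₂ e′)) → Σ[ k ∈ ℕ ] length (incs H w) ≡ k + k
    edge-edge-walk-even [] = 0 , refl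
    edge-edge-walk-even (step i (inj₁ (() , _)) w)
    edge-edge-walk-even (step i (inj₂ (refl , refl)) w) with vertex-edge-walk-odd w
    ... | k , len≡ = suc k , cong suc (trans len≡ (sym (+-suc k k)))

  module _ {v : V} {e : E} where
    halfLength : Walk H (inj₁ v) (inj₂ e) → ℕ
    halfLength P = proj₁ (vertex-edge-walk-odd P)

    pathSign : Walk H (inj₁ v) (inj₂ e) → Sign
    pathSign P = signPow H (halfLength P) *ₛ σ-product (incs H P)

    circleSign-circleOf : ∀ P Q → circleSign H (circleOf H P Q) ≡ Sign.- *ₛ (pathSign P *ₛ pathSign Q)
    circleSign-circleOf P Q = begin
      circleSign H (circleOf H P Q)
        ≡⟨ cong₂ (λ n s → signPow H ⌊ n /2⌋ *ₛ s) length-circle σ-product-circle ⟩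
      signPow H ⌊ suc (a + a) + suc (b + b) /2⌋ *ₛ (πP *ₛ πQ)
        ≡⟨ cong (λ n → signPow H n *ₛ (πP *ₛ πQ)) (⌊odd+odd/2⌋ a b) ⟩
      Sign.- *ₛ signPow H (a + b) *ₛ (πP *ₛ πQ)
        ≡⟨ cong (λ s → Sign.- *ₛ s *ₛ (πP *ₛ πQ)) (sym (signPow-+ H a b)) ⟩
      Sign.- *ₛ (signPow H a *ₛ signPow H b) *ₛ (πP *ₛ πQ)
        ≡⟨ *-assoc Sign.- (signPow H a *ₛ signPow H b) (πP *ₛ πQ) ⟩
      Sign.- *ₛ ((signPow H a *ₛ signPow H b) *ₛ (πP *ₛ πQ))
        ≡⟨ cong (Sign.- *ₛ_) (interchange (signPow H a) (signPow H b) πP πQ) ⟩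
      Sign.- *ₛ (pathSign P *ₛ pathSign Q) ∎
      where
      a b : ℕ
      a = halfLength P
      b = halfLength Q
      πP πQ : Sign
      πP = σ-product (incs H P)
      πQ = σ-product (incs H Q)
      incs-circle : incs H (circleOf H P Q) ≡ incs H P ++ reverse (incs H Q)
      incs-circle = trans (incs-++ʷ P (reverseʷ H Q)) (cong (incs H P ++_) (incs-reverseʷ Q))
      length-circle : length (incs H (circleOf H P Q)) ≡ suc (a + a) + suc (b + b)
      length-circle = begin
        length (incs H (circleOf H P Q))                  ≡⟨ cong length incs-circle ⟩
        length (incs H P ++ reverse (incs H Q))           ≡⟨ length-++ (incs H P) ⟩
        length (incs H P) + length (reverse (incs H Q))   ≡⟨ cong (length (incs H P) +_) (length-reverse (incs H Q)) ⟩
        length (incs H P) + length (incs H Q)             ≡⟨ cong₂ _+_ (proj₂ (vertex-edge-walk-odd P)) (proj₂ (vertex-edge-walk-odd Q)) ⟩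
        suc (a + a) + suc (b + b)                         ∎
      σ-product-circle : σ-product (incs H (circleOf H P Q)) ≡ πP *ₛ πQ
      σ-product-circle = begin
        σ-product (incs H (circleOf H P Q))                        ≡⟨ cong σ-product incs-circle ⟩
        σ-product (incs H P ++ reverse (incs H Q))                 ≡⟨ σ-product-++ (incs H P) (reverse (incs H Q)) ⟩
        σ-product (incs H P) *ₛ σ-product (reverse (incs H Q))     ≡⟨ cong (σ-product (incs H P) *ₛ_) (σ-product-reverse (incs H Q)) ⟩
        σ-product (incs H P) *ₛ σ-product (incs H Q)               ∎

-- Only the odd length of vertex-to-edge walks matters.
mainTheorem6 : (H : OrientedHypergraph) → (v : OrientedHypergraph.V H) → (e : OrientedHypergraph.E H)
    → (P₁ P₂ P₃ : Walk H (inj₁ v) (inj₂ e))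
    → IsCrossTheta H P₁ P₂ P₃
    → (negCount H (circleSign H (circleOf H P₁ P₂))
       + negCount H (circleSign H (circleOf H P₁ P₃))
       + negCount H (circleSign H (circleOf H P₂ P₃))) % 2 ≡ 1
mainTheorem6 H v e P₁ P₂ P₃ _
  rewrite circleSign-circleOf P₁ P₂ | circleSign-circleOf P₁ P₃ | circleSign-circleOf P₂ P₃ =
  negCount-pairwise-odd H (pathSign P₁) (pathSign P₂) (pathSign P₃)
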